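{- Let $f$ be any nested canalyzing function in $n\ge 2$ variables. Then $s(f)=bs(f)$.
   Context: Work over $\mathbb{F}_2$, $\overline{a}=a\oplus 1$. A Boolean function $f:\mathbb{F}_2^n\to\mathbb{F}_2$ is nested canalyzing if there exist a permutation $\sigma$ of $\{1,\dots,n\}$ and $a_1,\dots,a_n,b_1,\dots,b_n\in\mathbb{F}_2$ such that $f=b_1$ when $x_{\sigma(1)}=a_1$; $f=b_k$ when $x_{\sigma(j)}=\overline{a_j}$ for $j<k$ and $x_{\sigma(k)}=a_k$ ($k=2,\dots,n$); and $f=\overline{b_n}$ when $x_{\sigma(j)}=\overline{a_j}$ for all $j$. For $\mathbf{x}\in\mathbb{F}_2^n$ and $S\subseteq[n]$, $\mathbf{x}^S$ is $\mathbf{x}$ with the bits indexed by $S$ complemented, $\mathbf{x}^i=\mathbf{x}^{\{i\}}$. Sensitivity: $s(f;\mathbf{x})=\#\{i: f(\mathbf{x}^i)\ne f(\mathbf{x})\}$, $s(f)=\max_{\mathbf{x}}s(f;\mathbf{x})$. Block sensitivity: $bs(f;\mathbf{x})$ is the maximum number of pairwise disjoint subsets $B_1,\dots,B_t\subseteq[n]$ with $f(\mathbf{x}^{B_j})\ne f(\mathbf{x})$ for all $j$, and $bs(f)=\max_{\mathbf{x}}bs(f;\mathbf{x})$. -}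

module Defs where

open import Data.Bool using (Bool; true; false; not; _xor_; _∧_; _∨_; if_then_else_)
open import Data.Bool.Properties using () renaming (_≟_ to _≟ᵇ_)
open import Data.Nat using (ℕ; zero; suc; _⊔_)
open import Data.Fin using (Fin; zero; suc; fromℕ)
import Data.Vec
open import Data.Vec using (Vec; []; _∷_; zipWith; lookup; tabulate)
open import Data.List using (List; []; _∷_; map; concatMap; filter; length; foldr; _++_)
open import Data.List using () renaming (allFin to allFinL)
open import Data.Fin.Permutation using (Permutation′; _⟨$⟩ʳ_)
open import Data.Product using (Σ; ∃; _×_; _,_)
open import Relation.Binary.PropositionalEquality using (_≡_)
open import Relation.Nullary using (¬_; Dec; yes; no)
open import Relation.Nullary.Decidable using (¬?)

-- Points of F_2^n are vectors of Booleans (false = 0, true = 1); xor is addition in F_2.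
Point : ℕ → Set
Point n = Vec Bool n

BoolFun : ℕ → Set
BoolFun n = Point n → Bool

-- All points of F_2^n (also used as all subsets S ⊆ [n], via indicator vectors).
allPoints : (n : ℕ) → List (Point n)
allPoints zero    = [] ∷ []
allPoints (suc n) = map (false ∷_) (allPoints n) ++ map (true ∷_) (allPoints n)

-- x^S : complement the bits of x indexed by S (S given by its indicator vector).
flipSet : ∀ {n} → Point n → Point n → Point n
flipSet x S = zipWith _xor_ x S

single : ∀ {n} → Fin n → Point n
single {n} i = tabulate (λ j → isEq i j)
  where
  isEq : ∀ {m} → Fin m → Fin m → Bool
  isEq zero    zero    = true
  isEq zero    (suc _) = false
  isEq (suc _) zero    = false
  isEq (suc a) (suc b) = isEq a b

flipAt : ∀ {n} → Point n → Fin n → Point n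
flipAt x i = flipSet x (single i)

sensitiveTo? : ∀ {n} (f : BoolFun n) (x S : Point n) → Dec (¬ (f (flipSet x S) ≡ f x))
sensitiveTo? f x S = ¬? (f (flipSet x S) ≟ᵇ f x)

maxList : List ℕ → ℕ
maxList = foldr _⊔_ 0

sensAt : ∀ {n} → BoolFun n → Point n → ℕ
sensAt {n} f x = length (filter (λ i → sensitiveTo? f x (single i)) (allFinL n))

sensitivity : ∀ {n} → BoolFun n → ℕ
sensitivity {n} f = maxList (map (sensAt f) (allPoints n))

disjoint : ∀ {n} → Point n → Point n → Bool
disjoint []       []       = true
disjoint (a ∷ S) (b ∷ T) = not (a ∧ b) ∧ disjoint S T

union : ∀ {n} → Point n → Point n → Point n
union S T = zipWith _∨_ S T

-- maxDisjointFrom U Bs: maximum size of a subfamily of Bs whose members are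
-- pairwise disjoint and disjoint from U (U = union of the blocks chosen so far)
maxDisjointFrom : ∀ {n} → Point n → List (Point n) → ℕ
maxDisjointFrom U []       = 0
maxDisjointFrom U (B ∷ Bs) with disjoint U B
... | true  = maxDisjointFrom U Bs ⊔ suc (maxDisjointFrom (union U B) Bs)
... | false = maxDisjointFrom U Bs

maxDisjoint : ∀ {n} → List (Point n) → ℕ
maxDisjoint {n} Bs = maxDisjointFrom (Data.Vec.replicate n false) Bs

blockSensAt : ∀ {n} → BoolFun n → Point n → ℕ
blockSensAt {n} f x = maxDisjoint (filter (sensitiveTo? f x) (allPoints n))

blockSensitivity : ∀ {n} → BoolFun n → ℕ
blockSensitivity {n} f = maxList (map (blockSensAt f) (allPoints n))

-- Evaluation of the nested canalyzing function with data (σ, a, b), 0-indexed: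
-- scan k = 0,1,..,n-1; the first k with x_{σ(k)} = a_k gives value b_k;
-- if x_{σ(k)} = not a_k for all k, the value is not b_{n-1}.
scanLayers : ∀ {n} → Point n → Permutation′ n → (Fin n → Bool) → (Fin n → Bool)
           → Bool → List (Fin n) → Bool
scanLayers x σ a b default []       = default
scanLayers x σ a b default (k ∷ ks) with lookup x (σ ⟨$⟩ʳ k) ≟ᵇ a k
... | yes _ = b k
... | no _  = scanLayers x σ a b default ks

ncfEval : ∀ {n} → Permutation′ n → (Fin n → Bool) → (Fin n → Bool) → Point n → Bool
ncfEval {zero}  σ a b x = false  -- n = 0 does not occur (the theorem assumes n ≥ 2)
ncfEval {suc m} σ a b x = scanLayers x σ a b (not (b (fromℕ m))) (allFinL (suc m))

IsNestedCanalyzing : ∀ {n} → BoolFun n → Set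
IsNestedCanalyzing {n} f =
  Σ (Permutation′ n) λ σ → Σ (Fin n → Bool) λ a → Σ (Fin n → Bool) λ b →
    ∀ (x : Point n) → f x ≡ ncfEval σ a b x

module Submission where

-- s(f) ≤ bs(f) holds for every Boolean function: at a point x the coordinates to which
-- f is sensitive form that many pairwise disjoint sensitive singleton blocks.
--
-- For bs(f) ≤ s(f) it suffices to give, for every point x, a certificate: a set T of
-- variables meeting every block B with f(x^B) ≠ f(x), and a point z at which f is
-- sensitive to every variable of T.  A disjoint family of sensitive blocks at x then has
-- at most |T| members, so bs(f;x) ≤ |T| ≤ s(f;z) ≤ s(f).  For a nested canalyzing f the
-- certificate is built along the canalyzing order, from the last layer outwards: if x
-- fires the current layer, T is that layer's variable alone; otherwise T is the
-- certificate of the later layers, enlarged by the current variable exactly when the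
-- layer's output differs from the value at x.  Making z sensitive to a firing layer uses
-- that no layer's output is forced by the layers after it.

open import Data.Bool using (Bool; true; false; not; _xor_; _∧_)
open import Data.Bool.Properties
  using (∧-conicalʳ; xor-identityʳ; xor-comm; not-¬; not-involutive) renaming (_≟_ to _≟ᵇ_)
open import Data.Empty using (⊥-elim)
open import Data.Fin using (Fin; zero; suc; fromℕ)
open import Data.Fin.Permutation using (Permutation′; _⟨$⟩ʳ_; _⟨$⟩ˡ_; inverseˡ)
import Data.Fin.Properties as Fin
open import Data.Fin.Subset
  using (Subset; ⊥; ⁅_⁆; _∈_; _∉_; _⊆_; _∩_; _∪_; _─_; _-_; ∣_∣; Nonempty)
open import Data.Fin.Subset.Properties
  using (_∈?_; x∈⁅x⁆; x∈⁅y⁆⇒x≡y; x≢y⇒x∉⁅y⁆; ∉⊥; ∣⊥∣≡0; Empty-unique; ∪-identityʳ;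
         x∈p∩q⁺; x∈p∩q⁻; x∈p∪q⁺; x∈p∪q⁻; x∈p∧x∉q⇒x∈p─q; x∈p∧x≢y⇒x∈p-y;
         p─q─r≡p─q∪r; p─q⊆p; p─⊥≡p; p∩q≢∅⇒∣p─q∣<∣p∣; p⊆q⇒∣p∣≤∣q∣)
open import Data.List using (List; []; _∷_; map; filter; length; allFin)
import Data.List as List
open import Data.List.Membership.Propositional using () renaming (_∈_ to _∈ₗ_)
open import Data.List.Membership.Propositional.Properties using (∈-map⁺; ∈-++⁺ˡ; ∈-++⁺ʳ; ∈-filter⁺)
open import Data.List.Relation.Unary.All using (All; []; _∷_)
import Data.List.Relation.Unary.All as All
open import Data.List.Relation.Unary.All.Properties using (all-filter)
open import Data.List.Relation.Unary.Unique.Propositional using (Unique)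
open import Data.List.Relation.Unary.Unique.Propositional.Properties using (allFin⁺)
open import Data.List.Relation.Unary.AllPairs using (_∷_)
import Data.List.Relation.Unary.Any as Any
open import Data.Nat using (ℕ; zero; suc; _⊔_; _≤_; _≥_; z≤n; s≤s)
open import Data.Nat.Properties
  using (≤-refl; ≤-reflexive; ≤-trans; ≤-antisym; ⊔-lub; m≤m⊔n; m≤n⊔m; n≤1+n; module ≤-Reasoning)
open import Data.Product using (∃; _×_; _,_; proj₁; proj₂)
open import Data.Sum using (_⊎_; inj₁; inj₂)
open import Data.Unit using (⊤; tt)
open import Data.Vec using ([]; _∷_; lookup; tabulate; _[_]≔_; here; there)
import Data.Vec.Properties as Vec
open import Function using (_∘_; case_of_)
open import Level using (0ℓ)
open import Relation.Binary.PropositionalEquality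
  using (_≡_; _≢_; _≗_; refl; sym; trans; cong; subst; module ≡-Reasoning)
open import Relation.Nullary using (Dec; yes; no; does)
open import Relation.Nullary.Decidable using (_×-dec_; dec-true)
open import Relation.Unary using (Pred; Decidable)

open import Defs

-- Subsets of coordinates.  Defs represents a subset S ⊆ [n] by its indicator vector,
-- which is literally the library's Subset n; `union` is the library's _∪_.

single≡⁅⁆ : ∀ {n} (i : Fin n) → single i ≡ ⁅ i ⁆
single≡⁅⁆ zero    = cong (true ∷_) (empty _)
  where
  empty : ∀ n → tabulate {n = n} (λ _ → false) ≡ ⊥
  empty zero    = refl
  empty (suc n) = cong (false ∷_) (empty n)
single≡⁅⁆ (suc i) = cong (false ∷_) (single≡⁅⁆ i)

∣p∪⁅x⁆∣≤1+∣p∣ : ∀ {n} (p : Subset n) (x : Fin n) → ∣ p ∪ ⁅ x ⁆ ∣ ≤ suc ∣ p ∣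
∣p∪⁅x⁆∣≤1+∣p∣ (true  ∷ p) zero    rewrite ∪-identityʳ p = n≤1+n _
∣p∪⁅x⁆∣≤1+∣p∣ (false ∷ p) zero    rewrite ∪-identityʳ p = ≤-refl
∣p∪⁅x⁆∣≤1+∣p∣ (true  ∷ p) (suc x) = s≤s (∣p∪⁅x⁆∣≤1+∣p∣ p x)
∣p∪⁅x⁆∣≤1+∣p∣ (false ∷ p) (suc x) = ∣p∪⁅x⁆∣≤1+∣p∣ p x

∣p∣≤1+∣p-x∣ : ∀ {n} (p : Subset n) (x : Fin n) → ∣ p ∣ ≤ suc ∣ p - x ∣
∣p∣≤1+∣p-x∣ p x = ≤-trans (p⊆q⇒∣p∣≤∣q∣ p⊆p-x∪x) (∣p∪⁅x⁆∣≤1+∣p∣ (p - x) x)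
  where
  p⊆p-x∪x : p ⊆ (p - x) ∪ ⁅ x ⁆
  p⊆p-x∪x {y} y∈p with y Fin.≟ x
  ... | yes refl = x∈p∪q⁺ (inj₂ (x∈⁅x⁆ x))
  ... | no  y≢x  = x∈p∪q⁺ (inj₁ (x∈p∧x≢y⇒x∈p-y y∈p y≢x))

x∈p─q⇒x∉q : ∀ {n} (p q : Subset n) {x} → x ∈ p ─ q → x ∉ q
x∈p─q⇒x∉q (s ∷ p) (true ∷ q) ()          here
x∈p─q⇒x∉q (s ∷ p) (t ∷ q)    (there x∈) (there x∈q) = x∈p─q⇒x∉q p q x∈ x∈q

disjoint-sound : ∀ {n} {U B : Subset n} {i} → disjoint U B ≡ true → i ∈ U → i ∉ B
disjoint-sound ()  here        here
disjoint-sound {U = u ∷ _} {b ∷ _} d (there i∈U) (there i∈B) =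
  disjoint-sound (∧-conicalʳ (not (u ∧ b)) _ d) i∈U i∈B

disjoint-complete : ∀ {n} (U B : Subset n) → (∀ {i} → i ∈ U → i ∉ B) → disjoint U B ≡ true
disjoint-complete []          []          _ = refl
disjoint-complete (true  ∷ U) (true  ∷ B) h = ⊥-elim (h here here)
disjoint-complete (true  ∷ U) (false ∷ B) h = disjoint-complete U B (λ i∈U → h (there i∈U) ∘ there)
disjoint-complete (false ∷ U) (_     ∷ B) h = disjoint-complete U B (λ i∈U → h (there i∈U) ∘ there)

-- Upper bound: if every block of Bs meets T, each block of a disjoint family avoiding U
-- uses up a fresh element of T ─ U.
maxDisjointFrom≤ : ∀ {n} (T U : Subset n) (Bs : List (Subset n)) →
  All (λ B → Nonempty (T ∩ B)) Bs → maxDisjointFrom U Bs ≤ ∣ T ─ U ∣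
maxDisjointFrom≤ T U []       []                 = z≤n
maxDisjointFrom≤ T U (B ∷ Bs) ((i , i∈T∩B) ∷ allMeet) with disjoint U B in U∩B=∅
... | false = maxDisjointFrom≤ T U Bs allMeet
... | true  = ⊔-lub (maxDisjointFrom≤ T U Bs allMeet) (begin
      suc (maxDisjointFrom (U ∪ B) Bs) ≤⟨ s≤s (maxDisjointFrom≤ T (U ∪ B) Bs allMeet) ⟩
      suc ∣ T ─ (U ∪ B) ∣              ≡⟨ cong (suc ∘ ∣_∣) (sym (p─q─r≡p─q∪r T U B)) ⟩
      suc ∣ T ─ U ─ B ∣                ≤⟨ p∩q≢∅⇒∣p─q∣<∣p∣ (T ─ U) B (i , x∈p∩q⁺ (i∈T─U , i∈B)) ⟩
      ∣ T ─ U ∣                        ∎)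
  where
  open ≤-Reasoning
  i∈B : i ∈ B
  i∈B = proj₂ (x∈p∩q⁻ T B i∈T∩B)
  i∈T─U : i ∈ T ─ U
  i∈T─U = x∈p∧x∉q⇒x∈p─q (proj₁ (x∈p∩q⁻ T B i∈T∩B)) (λ i∈U → disjoint-sound U∩B=∅ i∈U i∈B)

maxDisjointFrom-skip : ∀ {n} (U B : Subset n) Bs → maxDisjointFrom U Bs ≤ maxDisjointFrom U (B ∷ Bs)
maxDisjointFrom-skip U B Bs with disjoint U B
... | true  = m≤m⊔n _ _
... | false = ≤-refl

maxDisjointFrom-take : ∀ {n} (U B : Subset n) Bs → disjoint U B ≡ true →
  suc (maxDisjointFrom (U ∪ B) Bs) ≤ maxDisjointFrom U (B ∷ Bs)
maxDisjointFrom-take U B Bs U∩B=∅ rewrite U∩B=∅ = m≤n⊔m _ _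

-- Lower bound: if Bs contains the singleton of every element of S ─ U, these singletons
-- form a disjoint family avoiding U.
≤maxDisjointFrom : ∀ {n} (S U : Subset n) (Bs : List (Subset n)) →
  (∀ {i} → i ∈ S ─ U → ⁅ i ⁆ ∈ₗ Bs) → ∣ S ─ U ∣ ≤ maxDisjointFrom U Bs
≤maxDisjointFrom {n} S U [] singletons =
  ≤-reflexive (trans (cong ∣_∣ (Empty-unique λ { (i , i∈) → case singletons i∈ of λ () })) (∣⊥∣≡0 n))
≤maxDisjointFrom S U (B ∷ Bs) singletons
  with Fin.any? (λ i → Vec.≡-dec _≟ᵇ_ B ⁅ i ⁆ ×-dec (i ∈? (S ─ U)))
... | yes (i , refl , i∈S─U) = begin
      ∣ S ─ U ∣                                ≤⟨ ∣p∣≤1+∣p-x∣ (S ─ U) i ⟩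
      suc ∣ S ─ U ─ ⁅ i ⁆ ∣                    ≡⟨ cong (suc ∘ ∣_∣) (p─q─r≡p─q∪r S U ⁅ i ⁆) ⟩
      suc ∣ S ─ (U ∪ ⁅ i ⁆) ∣                  ≤⟨ s≤s (≤maxDisjointFrom S (U ∪ ⁅ i ⁆) Bs remaining) ⟩
      suc (maxDisjointFrom (U ∪ ⁅ i ⁆) Bs)     ≤⟨ maxDisjointFrom-take U ⁅ i ⁆ Bs U∩⁅i⁆=∅ ⟩
      maxDisjointFrom U (⁅ i ⁆ ∷ Bs)            ∎
  where
  open ≤-Reasoning
  U∩⁅i⁆=∅ : disjoint U ⁅ i ⁆ ≡ true
  U∩⁅i⁆=∅ = disjoint-complete U ⁅ i ⁆
    (λ j∈U j∈⁅i⁆ → x∈p─q⇒x∉q S U i∈S─U (subst (_∈ U) (x∈⁅y⁆⇒x≡y i j∈⁅i⁆) j∈U))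
  remaining : ∀ {j} → j ∈ S ─ (U ∪ ⁅ i ⁆) → ⁅ j ⁆ ∈ₗ Bs
  remaining {j} j∈ = fromTail (singletons (p─q⊆p (S ─ U) ⁅ i ⁆ j∈′))
    where
    j∈′ : j ∈ S ─ U ─ ⁅ i ⁆
    j∈′ = subst (j ∈_) (sym (p─q─r≡p─q∪r S U ⁅ i ⁆)) j∈
    fromTail : ⁅ j ⁆ ∈ₗ ⁅ i ⁆ ∷ Bs → ⁅ j ⁆ ∈ₗ Bs
    fromTail (Any.there ⁅j⁆∈Bs) = ⁅j⁆∈Bs
    fromTail (Any.here ⁅j⁆≡⁅i⁆)  = ⊥-elim (x∈p─q⇒x∉q (S ─ U) ⁅ i ⁆ j∈′ (subst (j ∈_) ⁅j⁆≡⁅i⁆ (x∈⁅x⁆ j)))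
... | no notSingleton = ≤-trans (≤maxDisjointFrom S U Bs remaining) (maxDisjointFrom-skip U B Bs)
  where
  remaining : ∀ {j} → j ∈ S ─ U → ⁅ j ⁆ ∈ₗ Bs
  remaining {j} j∈ = fromTail (singletons j∈)
    where
    fromTail : ⁅ j ⁆ ∈ₗ B ∷ Bs → ⁅ j ⁆ ∈ₗ Bs
    fromTail (Any.there ⁅j⁆∈Bs) = ⁅j⁆∈Bs
    fromTail (Any.here ⁅j⁆≡B)   = ⊥-elim (notSingleton (j , sym ⁅j⁆≡B , j∈))

≤maxList : ∀ {A : Set} (g : A → ℕ) {y} ys → y ∈ₗ ys → g y ≤ maxList (map g ys)
≤maxList g (y ∷ ys) (Any.here refl) = m≤m⊔n _ _
≤maxList g (y ∷ ys) (Any.there y∈) = ≤-trans (≤maxList g ys y∈) (m≤n⊔m _ _)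

maxList≤ : ∀ {A : Set} (g : A → ℕ) {k} ys → (∀ y → g y ≤ k) → maxList (map g ys) ≤ k
maxList≤ g []       bound = z≤n
maxList≤ g (y ∷ ys) bound = ⊔-lub (bound y) (maxList≤ g ys bound)

allPoints-complete : ∀ {n} (x : Point n) → x ∈ₗ allPoints n
allPoints-complete []              = Any.here refl
allPoints-complete {suc n} (false ∷ x) = ∈-++⁺ˡ (∈-map⁺ (false ∷_) (allPoints-complete x))
allPoints-complete {suc n} (true  ∷ x) =
  ∈-++⁺ʳ (map (false ∷_) (allPoints n)) (∈-map⁺ (true ∷_) (allPoints-complete x))

length-filter≡∣tabulate∣ : ∀ {n} {A : Set} {P : Pred A 0ℓ} (P? : Decidable P) (g : Fin n → A) →
  length (filter P? (List.tabulate g)) ≡ ∣ tabulate (does ∘ P? ∘ g) ∣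
length-filter≡∣tabulate∣ {zero}  P? g = refl
length-filter≡∣tabulate∣ {suc n} P? g with P? (g zero)
... | yes _ = cong suc (length-filter≡∣tabulate∣ P? (g ∘ suc))
... | no  _ = length-filter≡∣tabulate∣ P? (g ∘ suc)

sensitiveSet : ∀ {n} → BoolFun n → Point n → Subset n
sensitiveSet f x = tabulate (λ i → does (sensitiveTo? f x (single i)))

sensAt≡∣sensitiveSet∣ : ∀ {n} (f : BoolFun n) (x : Point n) → sensAt f x ≡ ∣ sensitiveSet f x ∣
sensAt≡∣sensitiveSet∣ f x = length-filter≡∣tabulate∣ (λ i → sensitiveTo? f x (single i)) (λ i → i)

∈sensitiveSet⁺ : ∀ {n} (f : BoolFun n) (x : Point n) {i} → f (flipAt x i) ≢ f x → i ∈ sensitiveSet f x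
∈sensitiveSet⁺ f x {i} sensitive =
  Vec.lookup⇒[]= i _ (trans (Vec.lookup∘tabulate _ i) (dec-true (sensitiveTo? f x (single i)) sensitive))

∈sensitiveSet⁻ : ∀ {n} (f : BoolFun n) (x : Point n) {i} → i ∈ sensitiveSet f x → f (flipAt x i) ≢ f x
∈sensitiveSet⁻ f x {i} i∈ = witness (sensitiveTo? f x (single i))
  (trans (sym (Vec.lookup∘tabulate _ i)) (Vec.[]=⇒lookup i∈))
  where
  witness : ∀ {P : Set} (P? : Dec P) → does P? ≡ true → P
  witness (yes p) _ = p

sensAt≤blockSensAt : ∀ {n} (f : BoolFun n) (x : Point n) → sensAt f x ≤ blockSensAt f x
sensAt≤blockSensAt {n} f x = begin
  sensAt f x        ≡⟨ sensAt≡∣sensitiveSet∣ f x ⟩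
  ∣ S ∣             ≡⟨ cong ∣_∣ (sym (p─⊥≡p S)) ⟩
  ∣ S ─ ⊥ ∣         ≤⟨ ≤maxDisjointFrom S ⊥ _ singletons ⟩
  blockSensAt f x   ∎
  where
  open ≤-Reasoning
  S = sensitiveSet f x
  singletons : ∀ {i} → i ∈ S ─ ⊥ → ⁅ i ⁆ ∈ₗ filter (sensitiveTo? f x) (allPoints n)
  singletons {i} i∈ = ∈-filter⁺ (sensitiveTo? f x) (allPoints-complete ⁅ i ⁆)
    (subst (λ B → f (flipSet x B) ≢ f x) (single≡⁅⁆ i) (∈sensitiveSet⁻ f x (p─q⊆p S ⊥ i∈)))

sensitivity≤blockSensitivity : ∀ {n} (f : BoolFun n) → sensitivity f ≤ blockSensitivity f
sensitivity≤blockSensitivity {n} f = maxList≤ (sensAt f) (allPoints n) λ x →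
  ≤-trans (sensAt≤blockSensAt f x) (≤maxList (blockSensAt f) (allPoints n) (allPoints-complete x))

Transversal : ∀ {n} → BoolFun n → Point n → Subset n → Set
Transversal g x T = ∀ B → g (flipSet x B) ≢ g x → Nonempty (T ∩ B)

SensitiveOn : ∀ {n} → BoolFun n → Point n → Subset n → Set
SensitiveOn g z T = ∀ {i} → i ∈ T → g (flipAt z i) ≢ g z

Transversal-≗ : ∀ {n} {f g : BoolFun n} {x T} → f ≗ g → Transversal g x T → Transversal f x T
Transversal-≗ {x = x} f≗g transversal B changes =
  transversal B (λ eq → changes (trans (f≗g _) (trans eq (sym (f≗g x)))))

SensitiveOn-≗ : ∀ {n} {f g : BoolFun n} {z T} → f ≗ g → SensitiveOn g z T → SensitiveOn f z T
SensitiveOn-≗ {z = z} f≗g sensitive i∈T eq =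
  sensitive i∈T (trans (sym (f≗g _)) (trans eq (f≗g z)))

blockSensAt≤sensitivity : ∀ {n} (f : BoolFun n) {x z : Point n} {T : Subset n} →
  Transversal f x T → SensitiveOn f z T → blockSensAt f x ≤ sensitivity f
blockSensAt≤sensitivity {n} f {x} {z} {T} transversal sensitive = begin
  blockSensAt f x         ≤⟨ maxDisjointFrom≤ T ⊥ _ (All.map (λ {B} → transversal B)
                                                       (all-filter (sensitiveTo? f x) (allPoints n))) ⟩
  ∣ T ─ ⊥ ∣               ≡⟨ cong ∣_∣ (p─⊥≡p T) ⟩
  ∣ T ∣                   ≤⟨ p⊆q⇒∣p∣≤∣q∣ (∈sensitiveSet⁺ f z ∘ sensitive) ⟩
  ∣ sensitiveSet f z ∣    ≡⟨ sym (sensAt≡∣sensitiveSet∣ f z) ⟩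
  sensAt f z              ≤⟨ ≤maxList (sensAt f) (allPoints n) (allPoints-complete z) ⟩
  sensitivity f           ∎
  where open ≤-Reasoning

lookup-flip-∉ : ∀ {n} (x B : Point n) {i} → i ∉ B → lookup (flipSet x B) i ≡ lookup x i
lookup-flip-∉ x B {i} i∉B with lookup B i in B[i]
... | false = trans (Vec.lookup-zipWith _xor_ i x B) (trans (cong (lookup x i xor_) B[i]) (xor-identityʳ _))
... | true  = ⊥-elim (i∉B (Vec.lookup⇒[]= i B B[i]))

lookup-flip-∈ : ∀ {n} (x B : Point n) {i} → i ∈ B → lookup (flipSet x B) i ≡ not (lookup x i)
lookup-flip-∈ x B {i} i∈B =
  trans (Vec.lookup-zipWith _xor_ i x B) (trans (cong (lookup x i xor_) (Vec.[]=⇒lookup i∈B)) (xor-comm _ true))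

lookup-flipAt-self : ∀ {n} (x : Point n) i → lookup (flipAt x i) i ≡ not (lookup x i)
lookup-flipAt-self x i rewrite single≡⁅⁆ i = lookup-flip-∈ x ⁅ i ⁆ (x∈⁅x⁆ i)

lookup-flipAt-other : ∀ {n} (x : Point n) {i j} → j ≢ i → lookup (flipAt x i) j ≡ lookup x j
lookup-flipAt-other x {i} j≢i rewrite single≡⁅⁆ i = lookup-flip-∉ x ⁅ i ⁆ (x≢y⇒x∉⁅y⁆ j≢i)

lookup∘update-not : ∀ {n} (w : Point n) v c → lookup (w [ v ]≔ not c) v ≢ c
lookup∘update-not w v c eq = not-¬ refl (sym (trans (sym (Vec.lookup∘update v w (not c))) eq))

flip-agree : ∀ {n} {w w' : Point n} {v} → (∀ {j} → j ≢ v → lookup w j ≡ lookup w' j) →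
  ∀ B {j} → j ≢ v → lookup (flipSet w B) j ≡ lookup (flipSet w' B) j
flip-agree {w = w} {w'} agree B {j} j≢v = begin
  lookup (flipSet w B) j      ≡⟨ Vec.lookup-zipWith _xor_ j w B ⟩
  lookup w j xor lookup B j   ≡⟨ cong (_xor lookup B j) (agree j≢v) ⟩
  lookup w' j xor lookup B j  ≡⟨ Vec.lookup-zipWith _xor_ j w' B ⟨
  lookup (flipSet w' B) j     ∎
  where open ≡-Reasoning

-- Nested canalyzing functions with data (σ, a, b) in n = suc m variables.
-- Layer k reads the variable var k = σ(k) and fires when it equals a k.
module NestedCanalyzing {m : ℕ} (σ : Permutation′ (suc m)) (a b : Fin (suc m) → Bool) where

  var : Fin (suc m) → Fin (suc m)
  var k = σ ⟨$⟩ʳ k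

  var-injective : ∀ {k k'} → var k ≡ var k' → k ≡ k'
  var-injective {k} {k'} eq = trans (sym (inverseˡ σ)) (trans (cong (σ ⟨$⟩ˡ_) eq) (inverseˡ σ))

  -- The function computed by the layers ks scanned in order; if none fires its value is
  -- the default not (b last).  ncfEval σ a b is scan (allFin (suc m)).
  scan : List (Fin (suc m)) → BoolFun (suc m)
  scan ks x = scanLayers x σ a b (not (b (fromℕ m))) ks

  scan-fires : ∀ {k} ks x → lookup x (var k) ≡ a k → scan (k ∷ ks) x ≡ b k
  scan-fires {k} ks x fires with lookup x (var k) ≟ᵇ a k
  ... | yes _     = refl
  ... | no misses = ⊥-elim (misses fires)

  scan-passes : ∀ {k} ks x → lookup x (var k) ≢ a k → scan (k ∷ ks) x ≡ scan ks x
  scan-passes {k} ks x misses with lookup x (var k) ≟ᵇ a k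
  ... | yes fires = ⊥-elim (misses fires)
  ... | no _      = refl

  Avoids : List (Fin (suc m)) → Fin (suc m) → Set
  Avoids ks v = All (λ k → var k ≢ v) ks

  avoids-var : ∀ {k ks} → All (k ≢_) ks → Avoids ks (var k)
  avoids-var = All.map (λ k≢k' eq → k≢k' (sym (var-injective eq)))

  scan-local : ∀ {v} ks {w w'} → Avoids ks v →
    (∀ {j} → j ≢ v → lookup w j ≡ lookup w' j) → scan ks w ≡ scan ks w'
  scan-local []       _                 _     = refl
  scan-local (k ∷ ks) {w} {w'} (k≢v ∷ avoid) agree = byLayer (lookup w (var k) ≟ᵇ a k)
    where
    open ≡-Reasoning
    byLayer : Dec (lookup w (var k) ≡ a k) → scan (k ∷ ks) w ≡ scan (k ∷ ks) w'
    byLayer (yes fires)  = trans (scan-fires ks w fires) (sym (scan-fires ks w' (trans (sym (agree k≢v)) fires)))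
    byLayer (no  misses) = begin
      scan (k ∷ ks) w   ≡⟨ scan-passes ks w misses ⟩
      scan ks w         ≡⟨ scan-local ks avoid agree ⟩
      scan ks w'        ≡⟨ scan-passes ks w' (misses ∘ trans (agree k≢v)) ⟨
      scan (k ∷ ks) w'  ∎

  record Certificate (ks : List (Fin (suc m))) (x : Point (suc m)) : Set where
    field
      T           : Subset (suc m)
      z           : Point (suc m)
      transversal : Transversal (scan ks) x T
      sensitiveOn : SensitiveOn (scan ks) z T
      unread∉T    : ∀ {v} → Avoids ks v → v ∉ T
      sameValue   : scan ks z ≡ scan ks x

  certificate-[] : ∀ x → Certificate [] x
  certificate-[] x = record
    { T = ⊥ ; z = x
    ; transversal = λ B changes → ⊥-elim (changes refl)
    ; sensitiveOn = λ i∈⊥ → ⊥-elim (∉⊥ i∈⊥)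
    ; unread∉T    = λ _ → ∉⊥
    ; sameValue   = refl }

  -- x fires the first layer k.  Every sensitive block must flip var k, so T = ⁅ var k ⁆;
  -- for z take a point w at which the later layers do not give b k, and let it fire k.
  certificate-fires : ∀ {k} ks → Avoids ks (var k) → (∃ λ w → scan ks w ≢ b k) →
    ∀ x → lookup x (var k) ≡ a k → Certificate (k ∷ ks) x
  certificate-fires {k} ks avoid (w , w≢bk) x x-fires = record
    { T = ⁅ var k ⁆ ; z = z
    ; transversal = transversal
    ; sensitiveOn = sensitiveOn
    ; unread∉T    = λ { (k≢v ∷ _) v∈ → k≢v (sym (x∈⁅y⁆⇒x≡y _ v∈)) }
    ; sameValue   = trans (scan-fires ks z z-fires) (sym (scan-fires ks x x-fires)) }
    where
    open ≡-Reasoning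
    z = w [ var k ]≔ a k
    z-fires : lookup z (var k) ≡ a k
    z-fires = Vec.lookup∘update (var k) w (a k)

    transversal : Transversal (scan (k ∷ ks)) x ⁅ var k ⁆
    transversal B changes with var k ∈? B
    ... | yes k∈B = var k , x∈p∩q⁺ (x∈⁅x⁆ (var k) , k∈B)
    ... | no  k∉B = ⊥-elim (changes (trans (scan-fires ks (flipSet x B) (trans (lookup-flip-∉ x B k∉B) x-fires))
                                            (sym (scan-fires ks x x-fires))))

    sensitiveOn : SensitiveOn (scan (k ∷ ks)) z ⁅ var k ⁆
    sensitiveOn {i} i∈ rewrite x∈⁅y⁆⇒x≡y _ i∈ = λ eq → w≢bk (begin
      scan ks w                   ≡⟨ scan-local ks avoid agree ⟩
      scan ks z′                  ≡⟨ scan-passes ks z′ z′-misses ⟨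
      scan (k ∷ ks) z′            ≡⟨ eq ⟩
      scan (k ∷ ks) z             ≡⟨ scan-fires ks z z-fires ⟩
      b k                         ∎)
      where
      z′ = flipAt z (var k)
      z′-misses : lookup z′ (var k) ≢ a k
      z′-misses eq′ = not-¬ (sym z-fires) (trans (sym eq′) (lookup-flipAt-self z (var k)))
      agree : ∀ {j} → j ≢ var k → lookup w j ≡ lookup z′ j
      agree j≢k = trans (sym (Vec.lookup∘update′ j≢k w (a k))) (sym (lookup-flipAt-other z j≢k))

  -- x passes the first layer k.  From a certificate (T₀, z₀) for the later layers, build
  -- z from z₀ by setting var k so that layer k does not fire either; T₀ stays sensitive.
  module Passing {k} ks (avoid : Avoids ks (var k)) x (x-misses : lookup x (var k) ≢ a k)
                 (R : Certificate ks x) where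
    open Certificate R using () renaming
      (T to T₀; z to z₀; transversal to transversal₀; sensitiveOn to sensitiveOn₀;
       unread∉T to unread∉T₀; sameValue to sameValue₀)
    open ≡-Reasoning

    z : Point (suc m)
    z = z₀ [ var k ]≔ not (a k)

    z-misses : lookup z (var k) ≢ a k
    z-misses = lookup∘update-not z₀ (var k) (a k)

    z≈z₀ : ∀ {j} → j ≢ var k → lookup z j ≡ lookup z₀ j
    z≈z₀ j≢k = Vec.lookup∘update′ j≢k z₀ (not (a k))

    z-value : scan (k ∷ ks) z ≡ scan ks z₀
    z-value = trans (scan-passes ks z z-misses) (scan-local ks avoid z≈z₀)

    sameValue : scan (k ∷ ks) z ≡ scan (k ∷ ks) x
    sameValue = begin
      scan (k ∷ ks) z  ≡⟨ z-value ⟩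
      scan ks z₀       ≡⟨ sameValue₀ ⟩
      scan ks x        ≡⟨ scan-passes ks x x-misses ⟨
      scan (k ∷ ks) x  ∎

    -- Flipping a variable of T₀ at z leaves layer k passing, so it acts as at z₀.
    sensitiveOn-T₀ : SensitiveOn (scan (k ∷ ks)) z T₀
    sensitiveOn-T₀ {i} i∈T₀ eq = sensitiveOn₀ i∈T₀ (begin
      scan ks (flipAt z₀ i)       ≡⟨ scan-local ks avoid (flip-agree {w = z} {z₀} z≈z₀ (single i)) ⟨
      scan ks (flipAt z i)        ≡⟨ scan-passes ks (flipAt z i) misses ⟨
      scan (k ∷ ks) (flipAt z i)  ≡⟨ eq ⟩
      scan (k ∷ ks) z             ≡⟨ z-value ⟩
      scan ks z₀                  ∎)
      where
      i≢k : i ≢ var k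
      i≢k refl = unread∉T₀ avoid i∈T₀
      misses : lookup (flipAt z i) (var k) ≢ a k
      misses = z-misses ∘ trans (sym (lookup-flipAt-other z (i≢k ∘ sym)))

    firesOrMeets : ∀ B → scan (k ∷ ks) (flipSet x B) ≢ scan (k ∷ ks) x →
      lookup (flipSet x B) (var k) ≡ a k ⊎ Nonempty (T₀ ∩ B)
    firesOrMeets B changes = byLayer (lookup (flipSet x B) (var k) ≟ᵇ a k)
      where
      byLayer : Dec (lookup (flipSet x B) (var k) ≡ a k) →
        lookup (flipSet x B) (var k) ≡ a k ⊎ Nonempty (T₀ ∩ B)
      byLayer (yes fires)  = inj₁ fires
      byLayer (no  misses) = inj₂ (transversal₀ B λ eq → changes (begin
        scan (k ∷ ks) (flipSet x B)  ≡⟨ scan-passes ks (flipSet x B) misses ⟩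
        scan ks (flipSet x B)        ≡⟨ eq ⟩
        scan ks x                    ≡⟨ scan-passes ks x x-misses ⟨
        scan (k ∷ ks) x              ∎))

    -- If b k equals the value of x, firing layer k does not change the value: keep T₀.
    certificate-same : b k ≡ scan ks x → Certificate (k ∷ ks) x
    certificate-same bk≡ = record
      { T = T₀ ; z = z
      ; transversal = transversal
      ; sensitiveOn = sensitiveOn-T₀
      ; unread∉T    = λ { (_ ∷ avoid′) → unread∉T₀ avoid′ }
      ; sameValue   = sameValue }
      where
      transversal : Transversal (scan (k ∷ ks)) x T₀
      transversal B changes with firesOrMeets B changes
      ... | inj₂ meets = meets
      ... | inj₁ fires = ⊥-elim (changes (begin
        scan (k ∷ ks) (flipSet x B)  ≡⟨ scan-fires ks (flipSet x B) fires ⟩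
        b k                          ≡⟨ bk≡ ⟩
        scan ks x                    ≡⟨ scan-passes ks x x-misses ⟨
        scan (k ∷ ks) x              ∎))

    -- If b k differs from the value of x, firing layer k is a further sensitive block:
    -- add var k to T₀, at which z is sensitive since flipping it makes layer k fire.
    certificate-different : b k ≢ scan ks x → Certificate (k ∷ ks) x
    certificate-different bk≢ = record
      { T = T₀ ∪ ⁅ var k ⁆ ; z = z
      ; transversal = transversal
      ; sensitiveOn = sensitiveOn
      ; unread∉T    = unread∉T
      ; sameValue   = sameValue }
      where
      k∈T : var k ∈ T₀ ∪ ⁅ var k ⁆
      k∈T = x∈p∪q⁺ (inj₂ (x∈⁅x⁆ (var k)))

      transversal : Transversal (scan (k ∷ ks)) x (T₀ ∪ ⁅ var k ⁆)
      transversal B changes with firesOrMeets B changes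
      ... | inj₂ (i , i∈T₀∩B) = i , x∈p∩q⁺ (x∈p∪q⁺ (inj₁ (proj₁ i∈T₀,B)) , proj₂ i∈T₀,B)
        where i∈T₀,B = x∈p∩q⁻ T₀ B i∈T₀∩B
      ... | inj₁ fires with var k ∈? B
      ...   | yes k∈B = var k , x∈p∩q⁺ (k∈T , k∈B)
      ...   | no  k∉B = ⊥-elim (x-misses (trans (sym (lookup-flip-∉ x B k∉B)) fires))

      sensitiveOn : SensitiveOn (scan (k ∷ ks)) z (T₀ ∪ ⁅ var k ⁆)
      sensitiveOn {i} i∈ with x∈p∪q⁻ T₀ ⁅ var k ⁆ i∈
      ... | inj₁ i∈T₀ = sensitiveOn-T₀ i∈T₀
      ... | inj₂ i∈⁅k⁆ rewrite x∈⁅y⁆⇒x≡y _ i∈⁅k⁆ = λ eq → bk≢ (begin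
        b k                                ≡⟨ scan-fires ks (flipAt z (var k)) fires ⟨
        scan (k ∷ ks) (flipAt z (var k))   ≡⟨ eq ⟩
        scan (k ∷ ks) z                    ≡⟨ z-value ⟩
        scan ks z₀                         ≡⟨ sameValue₀ ⟩
        scan ks x                          ∎)
        where
        fires : lookup (flipAt z (var k)) (var k) ≡ a k
        fires = trans (lookup-flipAt-self z (var k))
                      (trans (cong not (Vec.lookup∘update (var k) z₀ (not (a k)))) (not-involutive (a k)))

      unread∉T : ∀ {v} → Avoids (k ∷ ks) v → v ∉ T₀ ∪ ⁅ var k ⁆
      unread∉T (k≢v ∷ avoid′) v∈ with x∈p∪q⁻ T₀ ⁅ var k ⁆ v∈
      ... | inj₁ v∈T₀  = unread∉T₀ avoid′ v∈T₀
      ... | inj₂ v∈⁅k⁆ = k≢v (sym (x∈⁅y⁆⇒x≡y _ v∈⁅k⁆))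

  Nondegenerate : List (Fin (suc m)) → Set
  Nondegenerate []       = ⊤
  Nondegenerate (k ∷ ks) = (∃ λ w → scan ks w ≢ b k) × Nondegenerate ks

  certificate : ∀ ks → Unique ks → Nondegenerate ks → ∀ x → Certificate ks x
  certificate []       _                   _                   x = certificate-[] x
  certificate (k ∷ ks) (k∉ks ∷ unique) (overruled , nondegenerate) x
    with lookup x (var k) ≟ᵇ a k
  ... | yes x-fires = certificate-fires ks (avoids-var k∉ks) overruled x x-fires
  ... | no x-misses with b k ≟ᵇ scan ks x
  ...   | yes bk≡ = Passing.certificate-same      ks (avoids-var k∉ks) x x-misses R bk≡
    where R = certificate ks unique nondegenerate x
  ...   | no  bk≢ = Passing.certificate-different ks (avoids-var k∉ks) x x-misses R bk≢
    where R = certificate ks unique nondegenerate x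

  -- EndsWith c ks: in the chain of outputs c, b k₁, …, b kᵣ of c followed by the layers
  -- ks = k₁ … kᵣ, the last one is the output of the last layer.
  EndsWith : Bool → List (Fin (suc m)) → Set
  EndsWith c []       = c ≡ b (fromℕ m)
  EndsWith c (k ∷ ks) = EndsWith (b k) ks

  -- Under EndsWith, scan ks is not constantly c: the default value differs from the last
  -- output, and each earlier output differs from the value obtained by firing it.
  notConstant : ∀ ks {c} → EndsWith c ks → Unique ks → ∃ λ w → scan ks w ≢ c
  notConstant []       c≡last _ = ⊥ , λ eq → not-¬ c≡last (sym eq)
  notConstant (k ∷ ks) {c} ends (k∉ks ∷ unique) with b k ≟ᵇ c
  ... | no  bk≢c = w , λ eq → bk≢c (trans (sym (scan-fires ks w (Vec.lookup∘update (var k) ⊥ (a k)))) eq)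
    where w = ⊥ [ var k ]≔ a k
  ... | yes refl = w , λ eq → w′≢bk (begin
      scan ks w′       ≡⟨ scan-local ks (avoids-var k∉ks) (λ j≢k → sym (Vec.lookup∘update′ j≢k w′ _)) ⟩
      scan ks w        ≡⟨ scan-passes ks w w-misses ⟨
      scan (k ∷ ks) w  ≡⟨ eq ⟩
      b k              ∎)
    where
    open ≡-Reasoning
    w′ = proj₁ (notConstant ks ends unique)
    w′≢bk = proj₂ (notConstant ks ends unique)
    w = w′ [ var k ]≔ not (a k)
    w-misses : lookup w (var k) ≢ a k
    w-misses = lookup∘update-not w′ (var k) (a k)

  nondegenerate : ∀ ks {c} → EndsWith c ks → Unique ks → Nondegenerate ks
  nondegenerate []       _    _                 = tt
  nondegenerate (k ∷ ks) ends (_ ∷ unique) = notConstant ks ends unique , nondegenerate ks ends unique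

  allFin-endsWith : EndsWith true (allFin (suc m))
  allFin-endsWith = tabulate-endsWith {true} m (λ k → k) refl
    where
    tabulate-endsWith : ∀ {c} r (g : Fin (suc r) → Fin (suc m)) →
      g (fromℕ r) ≡ fromℕ m → EndsWith c (List.tabulate g)
    tabulate-endsWith zero    g last = cong b last
    tabulate-endsWith (suc r) g last = tabulate-endsWith {b (g zero)} r (g ∘ suc) last

  blockSensitivity≤sensitivity : ∀ (f : BoolFun (suc m)) → f ≗ scan (allFin (suc m)) →
    blockSensitivity f ≤ sensitivity f
  blockSensitivity≤sensitivity f f≗scan = maxList≤ (blockSensAt f) (allPoints (suc m)) λ x →
    let open Certificate (certificate (allFin (suc m)) (allFin⁺ (suc m))
                            (nondegenerate _ {true} allFin-endsWith (allFin⁺ (suc m))) x)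
    in blockSensAt≤sensitivity f {x} {z} {T}
         (Transversal-≗ f≗scan transversal) (SensitiveOn-≗ f≗scan sensitiveOn)

theorem3p2 : (n : ℕ) → n ≥ 2 → (f : BoolFun n) → IsNestedCanalyzing f →
    sensitivity f ≡ blockSensitivity f
theorem3p2 zero    ()
theorem3p2 (suc m) _ f (σ , a , b , f≗ncf) =
  ≤-antisym (sensitivity≤blockSensitivity f)
            (NestedCanalyzing.blockSensitivity≤sensitivity σ a b f f≗ncf)
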